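{- Let $r,k$ be integers with $3\le k\le r$, and let $H$ be a linear $r$-uniform hypergraph on $n$ vertices containing no copy of $C_{1,k}^r$. Let $s$ denote the number of vertices of $H$ of degree at least $(k-1)(r-1)+2$. Then $$\sum_{e\in E(H)}\frac{1}{k(e)(r-1)+1}\le \frac{n-s}{r}.$$
   Context: An $r$-uniform hypergraph is linear if every pair of vertices lies in at most one edge. Degree of a vertex = number of edges containing it. For $t\ge 1$, the $t$-crown $C_{1,t}^r$ is the linear $r$-graph consisting of one base edge $e$ together with $t$ pairwise disjoint edges, each intersecting $e$ in exactly one vertex, these $t$ vertices being distinct. For an edge $e\in E(H)$, $k(e)$ is the maximum integer $t$ such that $e$ is the base edge of a copy of $C_{1,t}^r$ in $H$ (with $k(e)=0$ if $e$ is the base of no such copy with $t\ge1$). -}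

module Defs where

open import Data.Nat using (ℕ; zero; suc; _*_; _∸_; _≤_; _≤?_; NonZero)
open import Data.Fin using (Fin)
open import Data.Fin.Subset using (Subset; _∩_; ∣_∣; _∈_)
open import Data.Fin.Subset.Properties using (_∈?_)
open import Data.List using (List; length; filter; foldr; allFin)
open import Data.List.Membership.Propositional using () renaming (_∈_ to _∈ˡ_)
open import Data.List.Relation.Unary.All using (All)
open import Data.List.Relation.Unary.Unique.Propositional using (Unique)
open import Data.Integer using (+_)
open import Data.Rational using (ℚ; _+_; _/_; 0ℚ)
open import Data.Product using (Σ; _×_)
open import Relation.Binary.PropositionalEquality using (_≡_; _≢_)

record Hypergraph (n r : ℕ) : Set where
  field
    edges    : List (Subset n)
    distinct : Unique edges
    uniform  : All (λ e → ∣ e ∣ ≡ r) edges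
open Hypergraph public

Linear : ∀ {n r} → Hypergraph n r → Set
Linear H = ∀ {e f} → e ∈ˡ edges H → f ∈ˡ edges H → e ≢ f → ∣ e ∩ f ∣ ≤ 1

-- e is the base edge of a copy of the t-crown C_{1,t}^r in H:
-- t pairwise disjoint edges of H, each meeting e in exactly one vertex,
-- these t vertices being distinct.
CrownAt : ∀ {n r} → Hypergraph n r → Subset n → ℕ → Set
CrownAt {n} H e t =
  Σ (Fin t → Subset n) λ f →
    (∀ i → f i ∈ˡ edges H) ×
    (∀ i → ∣ f i ∩ e ∣ ≡ 1) ×
    (∀ i j → i ≢ j → ∣ f i ∩ f j ∣ ≡ 0) ×
    (∀ i j → i ≢ j → ∣ (f i ∩ e) ∩ (f j ∩ e) ∣ ≡ 0)

ContainsCrown : ∀ {n r} → Hypergraph n r → ℕ → Set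
ContainsCrown H t = Σ _ λ e → e ∈ˡ edges H × CrownAt H e t

-- κ e = k(e): the maximum t such that e is the base of a copy of C_{1,t}^r
-- (0 if there is no such copy with t ≥ 1; note CrownAt H e 0 always holds).
IsCrownNumber : ∀ {n r} → Hypergraph n r → (Subset n → ℕ) → Set
IsCrownNumber H κ =
  ∀ {e} → e ∈ˡ edges H → CrownAt H e (κ e) × (∀ t → CrownAt H e t → t ≤ κ e)

degree : ∀ {n r} → Hypergraph n r → Fin n → ℕ
degree H v = length (filter (v ∈?_) (edges H))

countDegAtLeast : ∀ {n r} → Hypergraph n r → ℕ → ℕ
countDegAtLeast {n} H d = length (filter (λ v → d ≤? degree H v) (allFin n))

crownSum : ∀ {n r} → Hypergraph n r → (Subset n → ℕ) → ℚ
crownSum {r = r} H κ = foldr (λ e acc → (+ 1 / suc (κ e * (r ∸ 1))) + acc) 0ℚ (edges H)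

module Submission where

-- Give each vertex v of degree d(v) < (k-1)(r-1)+2 the weight 1/d(v) and every other vertex the
-- weight 0.  Double counting gives Σ_e Σ_{v∈e} w(v) = Σ_v d(v) w(v) ≤ n - s, so it suffices to show
-- Σ_{v∈e} w(v) ≥ r/(k(e)(r-1)+1) for every edge e.  More generally, if S ⊆ e and crowns with base e
-- and feet in S have at most c < |S| legs, then Σ_{v∈S} w(v) ≥ |S|/(c(r-1)+1), by induction on c.
-- If every vertex of S has degree at most c(r-1)+1 this is immediate.  Otherwise take x ∈ S of larger
-- degree: by linearity each leg meets at most r-1 of the other edges through x, so every crown with
-- feet in S - x extends by an edge through x.  Hence crowns with feet in S - x have fewer than c legs,
-- and the induction hypothesis for S - x is strong enough to absorb x.  All weights are scaled by
-- D = ((k-1)(r-1)+1)!, which makes them natural numbers.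

open import Defs

open import Algebra.Properties.CommutativeSemigroup using (interchange)
import Data.Bool as Bool
open import Data.Bool using (if_then_else_)
open import Data.Fin using (Fin; zero; suc; inject≤)
open import Data.Fin.Properties as Fin using (inject≤-injective)
open import Data.Fin.Subset using (Subset; inside; outside; _∩_; _─_; _-_; ∣_∣; _∈_; _∉_; _⊆_; ⁅_⁆; Empty)
open import Data.Fin.Subset.Properties
open import Data.List using (List; []; _∷_; length; filter; map; foldr; lookup; allFin; tabulate)
open import Data.List.Properties using (filter-all; filter-some; length-filter; length-tabulate; map-cong; map-tabulate)
open import Data.List.Membership.Propositional using (lose; find) renaming (_∈_ to _∈ˡ_)
open import Data.List.Membership.Propositional.Properties using (∈-lookup; ∈-filter⁻)
open import Data.List.Relation.Unary.All as All using (All; []; _∷_)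
open import Data.List.Relation.Unary.All.Properties using (¬Any⇒All¬; ¬All⇒Any¬)
open import Data.List.Relation.Unary.AllPairs as AllPairs using (AllPairs)
open import Data.List.Relation.Unary.Any as Any using (Any; any?)
open import Data.List.Relation.Unary.Unique.Propositional using (Unique)
import Data.List.Relation.Unary.Unique.Propositional.Properties as Unique
import Data.Nat as ℕ
open import Data.Nat using (ℕ; zero; suc; _+_; _*_; _∸_; _!; _≤_; _<_; _≤?_; _<?_; z≤n; s≤s; NonZero)
open import Data.Nat.Divisibility using (_∣_; ∣-trans; m∣m*n; m≤n⇒m!∣n!)
open import Data.Nat.DivMod using (m/n*n≡m; m/n*n≤m)
open import Data.Nat.ListAction using (sum)
open import Data.Nat.Properties
open import Data.Nat.Tactic.RingSolver using (solve-∀)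
open import Data.Product using (_×_; _,_; proj₁; proj₂; ∃-syntax)
open import Data.Vec using ([]; _∷_; here; there)
open import Data.Vec.Properties using (≡-dec)
open import Function using (_∘_)
open import Relation.Binary.Definitions using (DecidableEquality)
open import Relation.Binary.PropositionalEquality
open import Relation.Nullary using (¬_; Dec; yes; no; does; contradiction)
open import Relation.Nullary.Decidable using (¬?; _×-dec_)
open import Relation.Unary using (Decidable)

private
  variable
    A B : Set
    n : ℕ

-- Sums and counts over lists

count : {P : A → Set} → Decidable P → List A → ℕ
count P? xs = length (filter P? xs)

sum-map-mono-≤ : ∀ {f g : A → ℕ} {xs} → All (λ x → f x ≤ g x) xs → sum (map f xs) ≤ sum (map g xs)
sum-map-mono-≤ []         = z≤n
sum-map-mono-≤ (le ∷ les) = +-mono-≤ le (sum-map-mono-≤ les)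

sum-map-< : ∀ {f g : A → ℕ} {xs} → All (λ x → f x ≤ g x) xs → Any (λ x → f x < g x) xs →
            sum (map f xs) < sum (map g xs)
sum-map-< (le ∷ les) (Any.here lt)  = +-mono-<-≤ lt (sum-map-mono-≤ les)
sum-map-< (le ∷ les) (Any.there lt) = +-mono-≤-< le (sum-map-< les lt)

sum-map-≤-* : ∀ {f : A → ℕ} {c xs} → All (λ x → f x ≤ c) xs → sum (map f xs) ≤ length xs * c
sum-map-≤-* []         = z≤n
sum-map-≤-* (le ∷ les) = +-mono-≤ le (sum-map-≤-* les)

*-sum-map : ∀ m (f : A → ℕ) xs → m * sum (map f xs) ≡ sum (map (λ x → m * f x) xs)
*-sum-map m f []       = *-zeroʳ m
*-sum-map m f (x ∷ xs) = trans (*-distribˡ-+ m (f x) _) (cong (_+_ (m * f x)) (*-sum-map m f xs))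

sum-map-+ : ∀ (f g : A → ℕ) xs → sum (map (λ x → f x + g x) xs) ≡ sum (map f xs) + sum (map g xs)
sum-map-+ f g []       = refl
sum-map-+ f g (x ∷ xs) =
  trans (cong (_+_ (f x + g x)) (sum-map-+ f g xs)) (interchange +-commutativeSemigroup (f x) (g x) _ _)

module _ {P : A → Set} (P? : Decidable P) where

  count-∷-≤ : ∀ x xs → count P? xs ≤ count P? (x ∷ xs)
  count-∷-≤ x xs with P? x
  ... | yes _ = n≤1+n _
  ... | no  _ = ≤-refl

  count-∷-< : ∀ {x} xs → P x → count P? xs < count P? (x ∷ xs)
  count-∷-< {x} xs px with P? x
  ... | yes _   = ≤-refl
  ... | no  ¬px = contradiction px ¬px

  count≤sum-map : ∀ (f : A → ℕ) → (∀ {x} → P x → 0 < f x) → ∀ xs → count P? xs ≤ sum (map f xs)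
  count≤sum-map f pos []       = z≤n
  count≤sum-map f pos (x ∷ xs) with P? x
  ... | yes px = +-mono-≤ (pos px) (count≤sum-map f pos xs)
  ... | no  _  = ≤-trans (count≤sum-map f pos xs) (m≤n+m _ (f x))

  sum-map≤*[length∸count] : ∀ {g : A → ℕ} {c} → (∀ x → g x ≤ c) → (∀ {x} → P x → g x ≡ 0) →
                            ∀ xs → sum (map g xs) ≤ c * (length xs ∸ count P? xs)
  sum-map≤*[length∸count] g≤c g≡0 []       = z≤n
  sum-map≤*[length∸count] {g} {c} g≤c g≡0 (x ∷ xs) with P? x
  ... | yes px = ≤-trans (≤-reflexive (cong (_+ sum (map g xs)) (g≡0 px))) (sum-map≤*[length∸count] g≤c g≡0 xs)
  ... | no  _  = begin
    g x + sum (map g xs)                 ≤⟨ +-mono-≤ (g≤c x) (sum-map≤*[length∸count] g≤c g≡0 xs) ⟩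
    c + c * (length xs ∸ count P? xs)    ≡⟨ *-suc c _ ⟨
    c * suc (length xs ∸ count P? xs)    ≡⟨ cong (c *_) (+-∸-assoc 1 (length-filter P? xs)) ⟨
    c * (suc (length xs) ∸ count P? xs)  ∎
    where open ≤-Reasoning

length≤sum-count : ∀ {Q : B → A → Set} (Q? : ∀ b → Decidable (Q b)) bs xs →
                   All (λ x → Any (λ b → Q b x) bs) xs → length xs ≤ sum (map (λ b → count (Q? b) xs) bs)
length≤sum-count Q? bs []       []               = z≤n
length≤sum-count Q? bs (x ∷ xs) (covered ∷ rest) =
  ≤-trans (s≤s (length≤sum-count Q? bs xs rest))
          (sum-map-< (All.universal (λ b → count-∷-≤ (Q? b) x xs) bs)
                     (Any.map (λ {b} → count-∷-< (Q? b) xs) covered))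

length≤1+count-≢ : ∀ (_≟_ : DecidableEquality A) z {xs} → Unique xs →
                   length xs ≤ suc (count (λ y → ¬? (y ≟ z)) xs)
length≤1+count-≢ _≟_ z {[]}     _                   = z≤n
length≤1+count-≢ _≟_ z {x ∷ xs} (x∉xs AllPairs.∷ uxs) with x ≟ z
... | yes refl = s≤s (≤-reflexive (cong length (sym (filter-all (λ y → ¬? (y ≟ z)) (All.map ≢-sym x∉xs)))))
... | no  _    = s≤s (length≤1+count-≢ _≟_ z uxs)

AllPairs-lookup : ∀ {R : A → A → Set} → (∀ {x y} → R x y → R y x) → ∀ {xs} → AllPairs R xs →
                  ∀ i j → i ≢ j → R (lookup xs i) (lookup xs j)
AllPairs-lookup sym-R (Rx AllPairs.∷ Rxs) zero    zero    i≢j = contradiction refl i≢j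
AllPairs-lookup sym-R (Rx AllPairs.∷ Rxs) zero    (suc j) i≢j = All.lookup Rx (∈-lookup j)
AllPairs-lookup sym-R (Rx AllPairs.∷ Rxs) (suc i) zero    i≢j = sym-R (All.lookup Rx (∈-lookup i))
AllPairs-lookup sym-R (Rx AllPairs.∷ Rxs) (suc i) (suc j) i≢j = AllPairs-lookup sym-R Rxs i j (i≢j ∘ cong suc)

AllPairs-mapWith : ∀ {P : A → Set} {R S : A → A → Set} → (∀ {x y} → P x → P y → R x y → S x y) →
                   ∀ {xs} → All P xs → AllPairs R xs → AllPairs S xs
AllPairs-mapWith f []         AllPairs.[]         = AllPairs.[]
AllPairs-mapWith f (px ∷ pxs) (Rx AllPairs.∷ Rxs) =
  All.zipWith (λ (py , Rxy) → f px py Rxy) (pxs , Rx) AllPairs.∷ AllPairs-mapWith f pxs Rxs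

-- Sums over subsets of Fin n

∑ : Subset n → (Fin n → ℕ) → ℕ
∑ []            f = 0
∑ (inside ∷ p)  f = f zero + ∑ p (f ∘ suc)
∑ (outside ∷ p) f = ∑ p (f ∘ suc)

∑-mono-≤ : ∀ (p : Subset n) {f g} → (∀ {x} → x ∈ p → f x ≤ g x) → ∑ p f ≤ ∑ p g
∑-mono-≤ []            le = z≤n
∑-mono-≤ (inside ∷ p)  le = +-mono-≤ (le here) (∑-mono-≤ p (le ∘ there))
∑-mono-≤ (outside ∷ p) le = ∑-mono-≤ p (le ∘ there)

∑-mono-⊆ : ∀ {p q : Subset n} f → p ⊆ q → ∑ p f ≤ ∑ q f
∑-mono-⊆ {p = []}          {[]}          f p⊆q = z≤n
∑-mono-⊆ {p = inside ∷ p}  {inside ∷ q}  f p⊆q = +-monoʳ-≤ (f zero) (∑-mono-⊆ (f ∘ suc) (drop-∷-⊆ p⊆q))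
∑-mono-⊆ {p = outside ∷ p} {inside ∷ q}  f p⊆q = ≤-trans (∑-mono-⊆ (f ∘ suc) (drop-∷-⊆ p⊆q)) (m≤n+m _ (f zero))
∑-mono-⊆ {p = outside ∷ p} {outside ∷ q} f p⊆q = ∑-mono-⊆ (f ∘ suc) (drop-∷-⊆ p⊆q)
∑-mono-⊆ {p = inside ∷ p}  {outside ∷ q} f p⊆q with p⊆q here
... | ()

∑-const : ∀ (p : Subset n) c → ∑ p (λ _ → c) ≡ ∣ p ∣ * c
∑-const []            c = refl
∑-const (inside ∷ p)  c = cong (_+_ c) (∑-const p c)
∑-const (outside ∷ p) c = ∑-const p c

∑-*ʳ : ∀ (p : Subset n) f m → ∑ p (λ x → f x * m) ≡ ∑ p f * m
∑-*ʳ []            f m = refl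
∑-*ʳ (inside ∷ p)  f m = trans (cong (_+_ (f zero * m)) (∑-*ʳ p (f ∘ suc) m)) (sym (*-distribʳ-+ m (f zero) _))
∑-*ʳ (outside ∷ p) f m = ∑-*ʳ p (f ∘ suc) m

∑≡sum-tabulate : ∀ (p : Subset n) f → ∑ p f ≡ sum (tabulate (λ x → if does (x ∈? p) then f x else 0))
∑≡sum-tabulate []            f = refl
∑≡sum-tabulate (inside ∷ p)  f = cong (_+_ (f zero)) (∑≡sum-tabulate p (f ∘ suc))
∑≡sum-tabulate (outside ∷ p) f = ∑≡sum-tabulate p (f ∘ suc)

∑≡sum-allFin : ∀ (p : Subset n) f → ∑ p f ≡ sum (map (λ x → if does (x ∈? p) then f x else 0) (allFin n))
∑≡sum-allFin {n} p f = trans (∑≡sum-tabulate p f) (cong sum (sym (map-tabulate {n = n} (λ x → x) _)))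

sum-∑≡sum-count* : ∀ (L : List (Subset n)) f →
                   sum (map (λ e → ∑ e f) L) ≡ sum (map (λ x → count (x ∈?_) L * f x) (allFin n))
sum-∑≡sum-count* {n} []      f = *-sum-map 0 f (allFin n)
sum-∑≡sum-count* {n} (e ∷ L) f = begin
  ∑ e f + sum (map (λ e → ∑ e f) L)
    ≡⟨ cong₂ _+_ (∑≡sum-allFin e f) (sum-∑≡sum-count* L f) ⟩
  sum (map [x∈e]*f (allFin n)) + sum (map (λ x → count (x ∈?_) L * f x) (allFin n))
    ≡⟨ sum-map-+ [x∈e]*f _ (allFin n) ⟨
  sum (map (λ x → [x∈e]*f x + count (x ∈?_) L * f x) (allFin n))
    ≡⟨ cong sum (map-cong count-∷ (allFin n)) ⟩
  sum (map (λ x → count (x ∈?_) (e ∷ L) * f x) (allFin n))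
    ∎
  where
  open ≡-Reasoning
  [x∈e]*f : Fin n → ℕ
  [x∈e]*f x = if does (x ∈? e) then f x else 0
  count-∷ : ∀ x → [x∈e]*f x + count (x ∈?_) L * f x ≡ count (x ∈?_) (e ∷ L) * f x
  count-∷ x with x ∈? e
  ... | yes _ = refl
  ... | no  _ = refl

_≟ₛ_ : DecidableEquality (Subset n)
_≟ₛ_ = ≡-dec Bool._≟_

meets? : ∀ (F G : Subset n) → Dec (∣ G ∩ F ∣ ≢ 0)
meets? F G = ¬? (∣ G ∩ F ∣ ≟ 0)

∣p─q∣+∣p∩q∣≡∣p∣ : ∀ (p q : Subset n) → ∣ p ─ q ∣ + ∣ p ∩ q ∣ ≡ ∣ p ∣
∣p─q∣+∣p∩q∣≡∣p∣ []            []            = refl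
∣p─q∣+∣p∩q∣≡∣p∣ (inside ∷ p)  (inside ∷ q)  = trans (+-suc _ _) (cong suc (∣p─q∣+∣p∩q∣≡∣p∣ p q))
∣p─q∣+∣p∩q∣≡∣p∣ (inside ∷ p)  (outside ∷ q) = cong suc (∣p─q∣+∣p∩q∣≡∣p∣ p q)
∣p─q∣+∣p∩q∣≡∣p∣ (outside ∷ p) (inside ∷ q)  = ∣p─q∣+∣p∩q∣≡∣p∣ p q
∣p─q∣+∣p∩q∣≡∣p∣ (outside ∷ p) (outside ∷ q) = ∣p─q∣+∣p∩q∣≡∣p∣ p q

∣p─q∣≡∣p∣∸∣p∩q∣ : ∀ (p q : Subset n) → ∣ p ─ q ∣ ≡ ∣ p ∣ ∸ ∣ p ∩ q ∣
∣p─q∣≡∣p∣∸∣p∩q∣ p q =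
  trans (sym (m+n∸n≡m ∣ p ─ q ∣ ∣ p ∩ q ∣)) (cong (_∸ ∣ p ∩ q ∣) (∣p─q∣+∣p∩q∣≡∣p∣ p q))

∣p∣≤1+∣p-x∣ : ∀ (p : Subset n) x → ∣ p ∣ ≤ suc ∣ p - x ∣
∣p∣≤1+∣p-x∣ p x = begin
  ∣ p ∣                      ≡⟨ ∣p─q∣+∣p∩q∣≡∣p∣ p ⁅ x ⁆ ⟨
  ∣ p - x ∣ + ∣ p ∩ ⁅ x ⁆ ∣  ≤⟨ +-monoʳ-≤ ∣ p - x ∣ ∣p∩⁅x⁆∣≤1 ⟩
  ∣ p - x ∣ + 1              ≡⟨ +-comm ∣ p - x ∣ 1 ⟩
  suc ∣ p - x ∣              ∎
  where
  open ≤-Reasoning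
  ∣p∩⁅x⁆∣≤1 : ∣ p ∩ ⁅ x ⁆ ∣ ≤ 1
  ∣p∩⁅x⁆∣≤1 = ≤-trans (∣p∩q∣≤∣q∣ p ⁅ x ⁆) (≤-reflexive (∣⁅x⁆∣≡1 x))

x∈p⇒0<∣p∣ : ∀ {x} {p : Subset n} → x ∈ p → 0 < ∣ p ∣
x∈p⇒0<∣p∣ x∈p = ≤-trans (s≤s z≤n) (x∈p⇒∣p-x∣<∣p∣ x∈p)

x≢y∈p⇒1<∣p∣ : ∀ {x y} {p : Subset n} → x ∈ p → y ∈ p → x ≢ y → 1 < ∣ p ∣
x≢y∈p⇒1<∣p∣ x∈p y∈p x≢y =
  ≤-trans (s≤s (x∈p⇒0<∣p∣ (x∈p∧x≢y⇒x∈p-y y∈p (x≢y ∘ sym)))) (x∈p⇒∣p-x∣<∣p∣ x∈p)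

x∉p-x : ∀ (p : Subset n) x → x ∉ p - x
x∉p-x (inside ∷ p)  zero    ()
x∉p-x (outside ∷ p) zero    ()
x∉p-x (s ∷ p)       (suc x) x∈p-x = x∉p-x p x (drop-there x∈p-x)

sum-∣∣≤∣∣-disjoint : ∀ (h : A → Subset n) {xs T} → AllPairs (λ a b → Empty (h a ∩ h b)) xs →
                     All (λ a → h a ⊆ T) xs → sum (map (λ a → ∣ h a ∣) xs) ≤ ∣ T ∣
sum-∣∣≤∣∣-disjoint h {[]}              _                      _                = z≤n
sum-∣∣≤∣∣-disjoint h {a ∷ xs} {T} (a#xs AllPairs.∷ disj) (ha⊆T ∷ hxs⊆T) = begin
  ∣ h a ∣ + sum (map (λ a → ∣ h a ∣) xs)
    ≤⟨ +-mono-≤ (p⊆q⇒∣p∣≤∣q∣ ha⊆T∩ha) (sum-∣∣≤∣∣-disjoint h disj hxs⊆T─ha) ⟩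
  ∣ T ∩ h a ∣ + ∣ T ─ h a ∣               ≡⟨ +-comm ∣ T ∩ h a ∣ _ ⟩
  ∣ T ─ h a ∣ + ∣ T ∩ h a ∣               ≡⟨ ∣p─q∣+∣p∩q∣≡∣p∣ T (h a) ⟩
  ∣ T ∣                                   ∎
  where
  open ≤-Reasoning
  ha⊆T∩ha : h a ⊆ T ∩ h a
  ha⊆T∩ha y∈ha = x∈p∩q⁺ (ha⊆T y∈ha , y∈ha)
  hb⊆T─ha : ∀ {b} → Empty (h a ∩ h b) × h b ⊆ T → h b ⊆ T ─ h a
  hb⊆T─ha (a#b , hb⊆T) {y} y∈hb =
    x∈p∧x∉q⇒x∈p─q (hb⊆T y∈hb) (λ y∈ha → a#b (y , x∈p∩q⁺ (y∈ha , y∈hb)))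
  hxs⊆T─ha : All (λ b → h b ⊆ T ─ h a) xs
  hxs⊆T─ha = All.zipWith hb⊆T─ha (a#xs , hxs⊆T)

-- Crowns

module _ {n r} (H : Hypergraph n r) where

  -- A crown with base e as a list of legs, whose feet F ∩ e must lie in S; unlike CrownAt it can be
  -- extended by consing a new leg.
  record Crown (e S : Subset n) (legs : List (Subset n)) : Set where
    field
      legs∈H    : All (_∈ˡ edges H) legs
      meet-once : All (λ F → ∣ F ∩ e ∣ ≡ 1) legs
      disjoint  : AllPairs (λ F G → ∣ F ∩ G ∣ ≡ 0) legs
      feet⊆S    : All (λ F → F ∩ e ⊆ S) legs
  open Crown

  LegsAtMost : Subset n → Subset n → ℕ → Set
  LegsAtMost e S c = ∀ {legs} → Crown e S legs → length legs ≤ c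

  Crown-[] : ∀ e S → Crown e S []
  Crown-[] e S = record { legs∈H = [] ; meet-once = [] ; disjoint = AllPairs.[] ; feet⊆S = [] }

  Crown-weaken : ∀ {e S S′ legs} → S ⊆ S′ → Crown e S legs → Crown e S′ legs
  Crown-weaken S⊆S′ C = record
    { legs∈H    = legs∈H C
    ; meet-once = meet-once C
    ; disjoint  = disjoint C
    ; feet⊆S    = All.map (λ F∩e⊆S {y} y∈F∩e → S⊆S′ (F∩e⊆S y∈F∩e)) (feet⊆S C)
    }

  Crown⇒CrownAt : ∀ {e S legs} → Crown e S legs → CrownAt H e (length legs)
  Crown⇒CrownAt {e} {legs = legs} C =
    lookup legs , (λ i → All.lookup (legs∈H C) (∈-lookup i)) , (λ i → All.lookup (meet-once C) (∈-lookup i)) ,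
    legs-disjoint , feet-disjoint
    where
    legs-disjoint : ∀ i j → i ≢ j → ∣ lookup legs i ∩ lookup legs j ∣ ≡ 0
    legs-disjoint = AllPairs-lookup (λ {F} {G} ∣F∩G∣≡0 → trans (cong ∣_∣ (∩-comm G F)) ∣F∩G∣≡0) (disjoint C)
    feet⊆legs : ∀ F G → (F ∩ e) ∩ (G ∩ e) ⊆ F ∩ G
    feet⊆legs F G y∈ with x∈p∩q⁻ (F ∩ e) (G ∩ e) y∈
    ... | y∈F∩e , y∈G∩e = x∈p∩q⁺ (p∩q⊆p F e y∈F∩e , p∩q⊆p G e y∈G∩e)
    feet-disjoint : ∀ i j → i ≢ j → ∣ (lookup legs i ∩ e) ∩ (lookup legs j ∩ e) ∣ ≡ 0
    feet-disjoint i j i≢j = n≤0⇒n≡0 (≤-trans (p⊆q⇒∣p∣≤∣q∣ (feet⊆legs (lookup legs i) (lookup legs j)))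
                                             (≤-reflexive (legs-disjoint i j i≢j)))

  CrownAt-shrink : ∀ {e t u} → t ≤ u → CrownAt H e u → CrownAt H e t
  CrownAt-shrink {t = t} {u} t≤u (f , f∈H , meet , disj , feet-disj) =
    f ∘ inj , f∈H ∘ inj , meet ∘ inj ,
    (λ i j i≢j → disj (inj i) (inj j) (i≢j ∘ inj-injective i j)) ,
    (λ i j i≢j → feet-disj (inj i) (inj j) (i≢j ∘ inj-injective i j))
    where
    inj : Fin t → Fin u
    inj i = inject≤ i t≤u
    inj-injective : ∀ i j → inj i ≡ inj j → i ≡ j
    inj-injective = inject≤-injective t≤u t≤u

  0<degree : ∀ {e x} → e ∈ˡ edges H → x ∈ e → 0 < degree H x
  0<degree {x = x} e∈H x∈e = filter-some (x ∈?_) (lose e∈H x∈e)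

  otherEdgesThrough : Fin n → Subset n → List (Subset n)
  otherEdgesThrough x e = filter (λ G → ¬? (G ≟ₛ e)) (filter (x ∈?_) (edges H))

  ∈-otherEdgesThrough⁻ : ∀ {x e G} → G ∈ˡ otherEdgesThrough x e → G ∈ˡ edges H × x ∈ G × G ≢ e
  ∈-otherEdgesThrough⁻ {x} {e} G∈ with ∈-filter⁻ (λ G → ¬? (G ≟ₛ e)) G∈
  ... | G∈through , G≢e with ∈-filter⁻ (x ∈?_) G∈through
  ...   | G∈H , x∈G = G∈H , x∈G , G≢e

  otherEdgesThrough-unique : ∀ x e → Unique (otherEdgesThrough x e)
  otherEdgesThrough-unique x e = Unique.filter⁺ (λ G → ¬? (G ≟ₛ e)) (Unique.filter⁺ (x ∈?_) (distinct H))

  degree≤1+∣otherEdgesThrough∣ : ∀ x e → degree H x ≤ suc (length (otherEdgesThrough x e))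
  degree≤1+∣otherEdgesThrough∣ x e = length≤1+count-≢ _≟ₛ_ e (Unique.filter⁺ (x ∈?_) (distinct H))

module _ {n r} {H : Hypergraph n r} (linear : Linear H) where

  open Crown

  common-vertex-unique : ∀ {G G′ x y} → G ∈ˡ edges H → G′ ∈ˡ edges H → G ≢ G′ →
                         x ∈ G → x ∈ G′ → y ∈ G → y ∈ G′ → y ≡ x
  common-vertex-unique {x = x} {y} G∈H G′∈H G≢G′ x∈G x∈G′ y∈G y∈G′ with y Fin.≟ x
  ... | yes y≡x = y≡x
  ... | no  y≢x = contradiction (linear G∈H G′∈H G≢G′)
                    (<⇒≱ (x≢y∈p⇒1<∣p∣ (x∈p∩q⁺ (y∈G , y∈G′)) (x∈p∩q⁺ (x∈G , x∈G′)) y≢x))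

  -- By linearity the other edges through x meet F in pairwise disjoint subsets of F ─ e.
  leg-meets-few : ∀ {e F x} → e ∈ˡ edges H → x ∈ e → F ∈ˡ edges H → ∣ F ∩ e ∣ ≡ 1 → x ∉ F →
                  count (meets? F) (otherEdgesThrough H x e) ≤ r ∸ 1
  leg-meets-few {e} {F} {x} e∈H x∈e F∈H ∣F∩e∣≡1 x∉F = begin
    count (meets? F) others
      ≤⟨ count≤sum-map (meets? F) (λ G → ∣ G ∩ F ∣) n≢0⇒n>0 others ⟩
    sum (map (λ G → ∣ G ∩ F ∣) others)
      ≤⟨ sum-∣∣≤∣∣-disjoint (_∩ F) pairwise-disjoint (All.tabulate meets⊆F─e) ⟩
    ∣ F ─ e ∣                           ≡⟨ ∣p─q∣≡∣p∣∸∣p∩q∣ F e ⟩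
    ∣ F ∣ ∸ ∣ F ∩ e ∣                   ≡⟨ cong₂ _∸_ (All.lookup (uniform H) F∈H) ∣F∩e∣≡1 ⟩
    r ∸ 1                               ∎
    where
    open ≤-Reasoning
    others : List (Subset n)
    others = otherEdgesThrough H x e
    common∉F : ∀ {G G′ y} → G ∈ˡ edges H → G′ ∈ˡ edges H → G ≢ G′ →
               x ∈ G → x ∈ G′ → y ∈ G → y ∈ G′ → y ∉ F
    common∉F G∈H G′∈H G≢G′ x∈G x∈G′ y∈G y∈G′ y∈F =
      x∉F (subst (_∈ F) (common-vertex-unique G∈H G′∈H G≢G′ x∈G x∈G′ y∈G y∈G′) y∈F)
    pairwise-disjoint : AllPairs (λ G G′ → Empty ((G ∩ F) ∩ (G′ ∩ F))) others
    pairwise-disjoint = AllPairs-mapWith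
      (λ (G∈H , x∈G , _) (G′∈H , x∈G′ , _) G≢G′ (y , y∈) →
         let y∈G∩F , y∈G′∩F = x∈p∩q⁻ _ _ y∈
             y∈G , y∈F = x∈p∩q⁻ _ _ y∈G∩F
         in common∉F G∈H G′∈H G≢G′ x∈G x∈G′ y∈G (p∩q⊆p _ _ y∈G′∩F) y∈F)
      (All.tabulate (∈-otherEdgesThrough⁻ H)) (otherEdgesThrough-unique H x e)
    meets⊆F─e : ∀ {G} → G ∈ˡ others → G ∩ F ⊆ F ─ e
    meets⊆F─e G∈ y∈G∩F with ∈-otherEdgesThrough⁻ H G∈ | x∈p∩q⁻ _ _ y∈G∩F
    ... | G∈H , x∈G , G≢e | y∈G , y∈F =
      x∈p∧x∉q⇒x∈p─q y∈F (λ y∈e → common∉F G∈H e∈H G≢e x∈G x∈e y∈G y∈e y∈F)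

  degree≤1+legs*[r-1] : ∀ {e S x legs} → e ∈ˡ edges H → S ⊆ e → x ∈ S → Crown H e (S - x) legs →
                        All (λ G → Any (λ F → ∣ G ∩ F ∣ ≢ 0) legs) (otherEdgesThrough H x e) →
                        degree H x ≤ suc (length legs * (r ∸ 1))
  degree≤1+legs*[r-1] {e} {S} {x} {legs} e∈H S⊆e x∈S C each-meets-a-leg = begin
    degree H x                                                   ≤⟨ degree≤1+∣otherEdgesThrough∣ H x e ⟩
    suc (length others)                                          ≤⟨ s≤s (length≤sum-count meets? legs others each-meets-a-leg) ⟩
    suc (sum (map (λ F → count (meets? F) others) legs))         ≤⟨ s≤s (sum-map-≤-* each-leg-meets-few) ⟩
    suc (length legs * (r ∸ 1))                                  ∎
    where
    open ≤-Reasoning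
    others : List (Subset n)
    others = otherEdgesThrough H x e
    x∉legs : All (x ∉_) legs
    x∉legs = All.map (λ F∩e⊆S-x x∈F → x∉p-x S x (F∩e⊆S-x (x∈p∩q⁺ (x∈F , S⊆e x∈S)))) (feet⊆S C)
    each-leg-meets-few : All (λ F → count (meets? F) others ≤ r ∸ 1) legs
    each-leg-meets-few =
      All.zipWith (λ ((F∈H , ∣F∩e∣≡1) , x∉F) → leg-meets-few e∈H (S⊆e x∈S) F∈H ∣F∩e∣≡1 x∉F)
                  (All.zip (legs∈H C , meet-once C) , x∉legs)

  add-leg : ∀ {e S x G legs} → e ∈ˡ edges H → S ⊆ e → x ∈ S → G ∈ˡ edges H → x ∈ G → G ≢ e →
            All (λ F → ∣ G ∩ F ∣ ≡ 0) legs → Crown H e (S - x) legs → Crown H e S (G ∷ legs)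
  add-leg {e} {S} {x} {G} e∈H S⊆e x∈S G∈H x∈G G≢e G#legs C = record
    { legs∈H    = G∈H ∷ legs∈H C
    ; meet-once = ≤-antisym (linear G∈H e∈H G≢e) (x∈p⇒0<∣p∣ (x∈p∩q⁺ (x∈G , S⊆e x∈S))) ∷ meet-once C
    ; disjoint  = G#legs AllPairs.∷ disjoint C
    ; feet⊆S    = G∩e⊆S ∷ feet⊆S (Crown-weaken H (p─q⊆p S ⁅ x ⁆) C)
    }
    where
    G∩e⊆S : G ∩ e ⊆ S
    G∩e⊆S y∈G∩e with x∈p∩q⁻ G e y∈G∩e
    ... | y∈G , y∈e = subst (_∈ S) (sym (common-vertex-unique G∈H e∈H G≢e x∈G (S⊆e x∈S) y∈G y∈e)) x∈S

  extend-crown : ∀ {e S x legs} → e ∈ˡ edges H → S ⊆ e → x ∈ S → Crown H e (S - x) legs →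
                 suc (length legs * (r ∸ 1)) < degree H x → ∃[ G ] Crown H e S (G ∷ legs)
  extend-crown {e} {S} {x} {legs} e∈H S⊆e x∈S C high
    with any? (λ G → All.all? (λ F → ∣ G ∩ F ∣ ≟ 0) legs) (otherEdgesThrough H x e)
  ... | yes avoiding =
    let G , G∈others , G#legs = find avoiding
        G∈H , x∈G , G≢e = ∈-otherEdgesThrough⁻ H G∈others
    in G , add-leg e∈H S⊆e x∈S G∈H x∈G G≢e G#legs C
  ... | no  none-avoiding = contradiction (degree≤1+legs*[r-1] e∈H S⊆e x∈S C each-meets-a-leg) (<⇒≱ high)
    where
    each-meets-a-leg : All (λ G → Any (λ F → ∣ G ∩ F ∣ ≢ 0) legs) (otherEdgesThrough H x e)
    each-meets-a-leg = All.map (λ {G} → ¬All⇒Any¬ (λ F → ∣ G ∩ F ∣ ≟ 0) legs)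
                               (¬Any⇒All¬ (otherEdgesThrough H x e) none-avoiding)

-- Vertex weights

m≤n⇒m∣n! : ∀ {m n} → 0 < m → m ≤ n → m ∣ n !
m≤n⇒m∣n! {suc m} _ m≤n = ∣-trans (m∣m*n (m !)) (m≤n⇒m!∣n! m≤n)

<⇒≤∸1 : ∀ {m n} → m < n → m ≤ n ∸ 1
<⇒≤∸1 (s≤s m≤n) = m≤n

[1+s]*D≤X*[1+[1+c]*q] : ∀ {q c s D X} → 0 < q → c < s → s * D ≤ X * suc (c * q) →
                        suc s * D ≤ X * suc (suc c * q)
[1+s]*D≤X*[1+[1+c]*q] {q} {c} {s} {D} {X} 0<q c<s sD≤X[1+cq] = begin
  D + s * D                ≤⟨ +-monoˡ-≤ (s * D) D≤Xq ⟩
  X * q + s * D            ≤⟨ +-monoʳ-≤ (X * q) sD≤X[1+cq] ⟩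
  X * q + X * suc (c * q)  ≡⟨ split X q c ⟩
  X * suc (suc c * q)      ∎
  where
  open ≤-Reasoning
  split : ∀ X q c → X * q + X * suc (c * q) ≡ X * suc (suc c * q)
  split = solve-∀
  regroup₁ : ∀ D c q → D * (suc c * q) ≡ suc c * D * q
  regroup₁ = solve-∀
  regroup₂ : ∀ X c q → X * suc (c * q) * q ≡ X * q * suc (c * q)
  regroup₂ = solve-∀
  -- Because s > c, the hypothesis already forces X ≥ D / q, which pays for the extra vertex.
  D≤Xq : D ≤ X * q
  D≤Xq = *-cancelʳ-≤ D (X * q) (suc (c * q)) (begin
    D * suc (c * q)      ≤⟨ *-monoʳ-≤ D (+-monoˡ-≤ (c * q) 0<q) ⟩
    D * (suc c * q)      ≡⟨ regroup₁ D c q ⟩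
    suc c * D * q        ≤⟨ *-monoˡ-≤ q (*-monoˡ-≤ D c<s) ⟩
    s * D * q            ≤⟨ *-monoˡ-≤ q sD≤X[1+cq] ⟩
    X * suc (c * q) * q  ≡⟨ regroup₂ X c q ⟩
    X * q * suc (c * q)  ∎)

weight : ℕ → ℕ → ℕ → ℕ
weight K D zero    = 0
weight K D (suc m) with K ≤? suc m
... | yes _ = 0
... | no  _ = D ℕ./ suc m

weight*m≤D : ∀ K D m → weight K D m * m ≤ D
weight*m≤D K D zero    = z≤n
weight*m≤D K D (suc m) with K ≤? suc m
... | yes _ = z≤n
... | no  _ = m/n*n≤m D (suc m)

K≤m⇒weight≡0 : ∀ K D {m} → K ≤ m → weight K D m ≡ 0
K≤m⇒weight≡0 K D {zero}  _   = refl
K≤m⇒weight≡0 K D {suc m} K≤m with K ≤? suc m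
... | yes _   = refl
... | no  K≰m = contradiction K≤m K≰m

D≤weight*b : ∀ K D {m b} → 0 < m → m ∣ D → ¬ K ≤ m → m ≤ b → D ≤ weight K D m * b
D≤weight*b K D {suc m} {b} _ m∣D K≰m m≤b with K ≤? suc m
... | yes K≤m = contradiction K≤m K≰m
... | no  _   = begin
  D                      ≡⟨ m/n*n≡m m∣D ⟨
  D ℕ./ suc m * suc m    ≤⟨ *-monoʳ-≤ (D ℕ./ suc m) m≤b ⟩
  D ℕ./ suc m * b        ∎
  where open ≤-Reasoning

module Weights {n r} {H : Hypergraph n r} (linear : Linear H) (k : ℕ) where

  q L D K : ℕ
  q = r ∸ 1
  L = suc ((k ∸ 1) * q)
  D = L !
  K = (k ∸ 1) * q + 2

  instance
    D≢0 : NonZero D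
    D≢0 = L !≢0

  w : Fin n → ℕ
  w x = weight K D (degree H x)

  D≤w*b : ∀ {e x b} → e ∈ˡ edges H → x ∈ e → degree H x ≤ b → b ≤ L → D ≤ w x * b
  D≤w*b {x = x} e∈H x∈e deg≤b b≤L =
    D≤weight*b K D 0<deg (m≤n⇒m∣n! 0<deg deg≤L) (<⇒≱ (≤-<-trans deg≤L L<K)) deg≤b
    where
    0<deg : 0 < degree H x
    0<deg = 0<degree H e∈H x∈e
    deg≤L : degree H x ≤ L
    deg≤L = ≤-trans deg≤b b≤L
    L<K : L < K
    L<K = ≤-reflexive (+-comm 2 ((k ∸ 1) * q))

  weight-bound-low-degrees : ∀ {e S c} → e ∈ˡ edges H → S ⊆ e → c ≤ k ∸ 1 →
                             (∀ {x} → x ∈ S → degree H x ≤ suc (c * q)) → ∣ S ∣ * D ≤ ∑ S w * suc (c * q)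
  weight-bound-low-degrees {e} {S} {c} e∈H S⊆e c≤k-1 low = begin
    ∣ S ∣ * D                      ≡⟨ ∑-const S D ⟨
    ∑ S (λ _ → D)
      ≤⟨ ∑-mono-≤ S (λ x∈S → D≤w*b e∈H (S⊆e x∈S) (low x∈S) (s≤s (*-monoˡ-≤ q c≤k-1))) ⟩
    ∑ S (λ x → w x * suc (c * q))  ≡⟨ ∑-*ʳ S w (suc (c * q)) ⟩
    ∑ S w * suc (c * q)            ∎
    where open ≤-Reasoning

  fewer-legs-avoiding-high-vertex : ∀ {e S x c} → e ∈ˡ edges H → S ⊆ e → x ∈ S → suc (c * q) < degree H x →
                                    LegsAtMost H e S c → ∀ {legs} → Crown H e (S - x) legs → length legs < c
  fewer-legs-avoiding-high-vertex {S = S} {x} {c} e∈H S⊆e x∈S high at-most {legs} C =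
    at-most (proj₂ (extend-crown linear e∈H S⊆e x∈S C (≤-<-trans (s≤s (*-monoˡ-≤ q legs≤c)) high)))
    where
    legs≤c : length legs ≤ c
    legs≤c = at-most (Crown-weaken H (p─q⊆p S ⁅ x ⁆) C)

  weight-bound : ∀ c {e S} → 0 < q → e ∈ˡ edges H → S ⊆ e → c ≤ k ∸ 1 → c < ∣ S ∣ →
                 LegsAtMost H e S c → ∣ S ∣ * D ≤ ∑ S w * suc (c * q)
  weight-bound-high-vertex : ∀ c {e S x} → 0 < q → e ∈ˡ edges H → S ⊆ e → c ≤ k ∸ 1 → c < ∣ S ∣ → x ∈ S →
                             (∀ {legs} → Crown H e (S - x) legs → length legs < c) →
                             ∣ S ∣ * D ≤ ∑ S w * suc (c * q)

  weight-bound c {e} {S} 0<q e∈H S⊆e c≤k-1 c<∣S∣ at-most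
    with Fin.any? (λ x → x ∈? S ×-dec suc (c * q) <? degree H x)
  ... | no  none-high = weight-bound-low-degrees e∈H S⊆e c≤k-1 (λ x∈S → ≮⇒≥ (λ high → none-high (_ , x∈S , high)))
  ... | yes (x , x∈S , high) = weight-bound-high-vertex c 0<q e∈H S⊆e c≤k-1 c<∣S∣ x∈S
                                 (fewer-legs-avoiding-high-vertex e∈H S⊆e x∈S high at-most)

  weight-bound-high-vertex zero 0<q e∈H S⊆e c≤k-1 c<∣S∣ x∈S fewer = contradiction (fewer (Crown-[] H _ _)) λ ()
  weight-bound-high-vertex (suc c) {e} {S} {x} 0<q e∈H S⊆e c<k-1 c<∣S∣ x∈S fewer = begin
    ∣ S ∣ * D                       ≤⟨ *-monoˡ-≤ D ∣S∣≤1+∣S-x∣ ⟩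
    suc ∣ S - x ∣ * D               ≤⟨ [1+s]*D≤X*[1+[1+c]*q] {X = ∑ (S - x) w} 0<q c<∣S-x∣ ih ⟩
    ∑ (S - x) w * suc (suc c * q)   ≤⟨ *-monoˡ-≤ _ (∑-mono-⊆ w (p─q⊆p S ⁅ x ⁆)) ⟩
    ∑ S w * suc (suc c * q)         ∎
    where
    open ≤-Reasoning
    ∣S∣≤1+∣S-x∣ : ∣ S ∣ ≤ suc ∣ S - x ∣
    ∣S∣≤1+∣S-x∣ = ∣p∣≤1+∣p-x∣ S x
    c<∣S-x∣ : c < ∣ S - x ∣
    c<∣S-x∣ = ≤-pred (≤-trans c<∣S∣ ∣S∣≤1+∣S-x∣)
    ih : ∣ S - x ∣ * D ≤ ∑ (S - x) w * suc (c * q)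
    ih = weight-bound c 0<q e∈H (S⊆e ∘ p─q⊆p S ⁅ x ⁆) (≤-trans (n≤1+n c) c<k-1) c<∣S-x∣ (≤-pred ∘ fewer)

module CrownFree {n r} {H : Hypergraph n r} (linear : Linear H) {k} (2≤k : 2 ≤ k) (k≤r : k ≤ r)
                 (crown-free : ¬ ContainsCrown H k) {κ} (isCrownNumber : IsCrownNumber H κ) where

  open Weights {H = H} linear k public

  0<q : 0 < q
  0<q = <⇒≤∸1 (≤-trans 2≤k k≤r)

  κ<k : ∀ {e} → e ∈ˡ edges H → κ e < k
  κ<k {e} e∈H with k ≤? κ e
  ... | yes k≤κ = contradiction (e , e∈H , CrownAt-shrink H k≤κ (proj₁ (isCrownNumber e∈H))) crown-free
  ... | no  k≰κ = ≰⇒> k≰κ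

  1+κq∣D : ∀ {e} → e ∈ˡ edges H → suc (κ e * q) ∣ D
  1+κq∣D e∈H = m≤n⇒m∣n! (s≤s z≤n) (s≤s (*-monoˡ-≤ q (<⇒≤∸1 (κ<k e∈H))))

  edge-weight-bound : ∀ {e} → e ∈ˡ edges H → r * (D ℕ./ suc (κ e * q)) ≤ ∑ e w
  edge-weight-bound {e} e∈H = *-cancelʳ-≤ _ _ (suc (κ e * q)) (begin
    r * (D ℕ./ suc (κ e * q)) * suc (κ e * q)  ≡⟨ *-assoc r _ _ ⟩
    r * (D ℕ./ suc (κ e * q) * suc (κ e * q))  ≡⟨ cong (r *_) (m/n*n≡m (1+κq∣D e∈H)) ⟩
    r * D                                      ≡⟨ cong (_* D) ∣e∣≡r ⟨
    ∣ e ∣ * D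
      ≤⟨ weight-bound (κ e) 0<q e∈H (λ x∈e → x∈e) (<⇒≤∸1 (κ<k e∈H)) κ<∣e∣ legs≤κ ⟩
    ∑ e w * suc (κ e * q)                      ∎)
    where
    open ≤-Reasoning
    ∣e∣≡r : ∣ e ∣ ≡ r
    ∣e∣≡r = All.lookup (uniform H) e∈H
    κ<∣e∣ : κ e < ∣ e ∣
    κ<∣e∣ = ≤-trans (κ<k e∈H) (≤-trans k≤r (≤-reflexive (sym ∣e∣≡r)))
    legs≤κ : LegsAtMost H e e (κ e)
    legs≤κ C = proj₂ (isCrownNumber e∈H) _ (Crown⇒CrownAt H C)

  total-weight-bound : r * sum (map (λ e → D ℕ./ suc (κ e * q)) (edges H)) ≤ D * (n ∸ countDegAtLeast H K)
  total-weight-bound = begin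
    r * sum (map (λ e → D ℕ./ suc (κ e * q)) (edges H))
      ≡⟨ *-sum-map r _ (edges H) ⟩
    sum (map (λ e → r * (D ℕ./ suc (κ e * q))) (edges H))
      ≤⟨ sum-map-mono-≤ (All.tabulate edge-weight-bound) ⟩
    sum (map (λ e → ∑ e w) (edges H))
      ≡⟨ sum-∑≡sum-count* (edges H) w ⟩
    sum (map (λ x → degree H x * w x) (allFin n))
      ≤⟨ sum-map≤*[length∸count] (λ x → K ≤? degree H x) deg*w≤D deg*w≡0 (allFin n) ⟩
    D * (length (allFin n) ∸ countDegAtLeast H K)
      ≡⟨ cong (λ m → D * (m ∸ countDegAtLeast H K)) (length-tabulate (λ x → x)) ⟩
    D * (n ∸ countDegAtLeast H K)
      ∎
    where
    open ≤-Reasoning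
    deg*w≤D : ∀ x → degree H x * w x ≤ D
    deg*w≤D x = ≤-trans (≤-reflexive (*-comm (degree H x) (w x))) (weight*m≤D K D (degree H x))
    deg*w≡0 : ∀ {x} → K ≤ degree H x → degree H x * w x ≡ 0
    deg*w≡0 {x} K≤deg = trans (cong (degree H x *_) (K≤m⇒weight≡0 K D K≤deg)) (*-zeroʳ (degree H x))

-- Unit fractions

open import Data.Integer as ℤ using (+_)
import Data.Integer.Properties as ℤ
open import Data.Integer.Tactic.RingSolver renaming (solve-∀ to ℤ-solve-∀)
open import Data.Rational as ℚ using (0ℚ; toℚᵘ; _/_) renaming (_≤_ to _≤ℚ_)
open import Data.Rational.Properties using (toℚᵘ-fromℚᵘ; toℚᵘ-homo-+; toℚᵘ-cancel-≤)
open import Data.Rational.Unnormalised as ᵘ using (mkℚᵘ; *≡*; *≤*)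
  renaming (_≃_ to _≃ᵘ_; _≤_ to _≤ᵘ_; _/_ to _/ᵘ_; _+_ to _+ᵘ_)
import Data.Rational.Unnormalised.Properties as ᵘ

toℚᵘ-/ : ∀ i d .{{_ : NonZero d}} → toℚᵘ (i / d) ≃ᵘ i /ᵘ d
toℚᵘ-/ i (suc d) = toℚᵘ-fromℚᵘ (mkℚᵘ i d)

+a/d≤+b/e : ∀ {a b} d e .{{_ : NonZero d}} .{{_ : NonZero e}} → e * a ≤ d * b → + a /ᵘ d ≤ᵘ + b /ᵘ e
+a/d≤+b/e {a} {b} (suc d) (suc e) ea≤db = *≤* (subst₂ ℤ._≤_ (ℤ.pos-* a (suc e)) (ℤ.pos-* b (suc d))
                                                 (ℤ.+≤+ (subst₂ _≤_ (*-comm (suc e) a) (*-comm (suc d) b) ea≤db)))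

+a/d++b/d≃+[a+b]/d : ∀ a b d .{{_ : NonZero d}} → + a /ᵘ d +ᵘ + b /ᵘ d ≃ᵘ + (a + b) /ᵘ d
+a/d++b/d≃+[a+b]/d a b (suc d) = *≡* (distrib (+ a) (+ b) (+ suc d))
  where
  distrib : ∀ x y z → (x ℤ.* z ℤ.+ y ℤ.* z) ℤ.* z ≡ (x ℤ.+ y) ℤ.* (z ℤ.* z)
  distrib = ℤ-solve-∀

+1/m≃+[d/m]/d : ∀ m d .{{_ : NonZero m}} .{{_ : NonZero d}} → m ∣ d → + 1 /ᵘ m ≃ᵘ + (d ℕ./ m) /ᵘ d
+1/m≃+[d/m]/d (suc m) (suc d) m∣d =
  *≡* (trans (cong +_ (trans (+-identityʳ (suc d)) (sym (m/n*n≡m m∣d)))) (ℤ.pos-* (suc d ℕ./ suc m) (suc m)))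

sum-unit-fractions : ∀ (m : A → ℕ) d .{{_ : NonZero d}} xs → All (λ x → suc (m x) ∣ d) xs →
                     toℚᵘ (foldr (λ x acc → + 1 / suc (m x) ℚ.+ acc) 0ℚ xs) ≃ᵘ
                     + sum (map (λ x → d ℕ./ suc (m x)) xs) /ᵘ d
sum-unit-fractions m (suc d) []       []               = *≡* refl
sum-unit-fractions m d       (x ∷ xs) (m+1∣d ∷ m+1∣ds) = begin
  toℚᵘ (+ 1 / suc (m x) ℚ.+ acc)           ≈⟨ toℚᵘ-homo-+ (+ 1 / suc (m x)) acc ⟩
  toℚᵘ (+ 1 / suc (m x)) +ᵘ toℚᵘ acc       ≈⟨ ᵘ.+-cong (ᵘ.≃-trans (toℚᵘ-/ (+ 1) (suc (m x))) (+1/m≃+[d/m]/d (suc (m x)) d m+1∣d))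
                                                      (sum-unit-fractions m d xs m+1∣ds) ⟩
  + (d ℕ./ suc (m x)) /ᵘ d +ᵘ + rest /ᵘ d  ≈⟨ +a/d++b/d≃+[a+b]/d (d ℕ./ suc (m x)) rest d ⟩
  + (d ℕ./ suc (m x) + rest) /ᵘ d          ∎
  where
  open ᵘ.≃-Reasoning
  acc : ℚ.ℚ
  acc = foldr (λ x acc → + 1 / suc (m x) ℚ.+ acc) 0ℚ xs
  rest : ℕ
  rest = sum (map (λ x → d ℕ./ suc (m x)) xs)

sum-unit-fractions-≤ : ∀ (m : A → ℕ) d e .{{_ : NonZero d}} .{{_ : NonZero e}} {N} xs →
                       All (λ x → suc (m x) ∣ d) xs →
                       e * sum (map (λ x → d ℕ./ suc (m x)) xs) ≤ d * N →
                       foldr (λ x acc → + 1 / suc (m x) ℚ.+ acc) 0ℚ xs ≤ℚ + N / e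
sum-unit-fractions-≤ m d e {N} xs m+1∣d e*Σ≤d*N = toℚᵘ-cancel-≤ (begin
  toℚᵘ (foldr (λ x acc → + 1 / suc (m x) ℚ.+ acc) 0ℚ xs)  ≃⟨ sum-unit-fractions m d xs m+1∣d ⟩
  + sum (map (λ x → d ℕ./ suc (m x)) xs) /ᵘ d             ≤⟨ +a/d≤+b/e d e e*Σ≤d*N ⟩
  + N /ᵘ e                                                ≃⟨ toℚᵘ-/ (+ N) e ⟨
  toℚᵘ (+ N / e)                                          ∎)
  where open ᵘ.≤-Reasoning

proposition1 : (r k n : ℕ) → .{{_ : NonZero r}} → 3 ≤ k → k ≤ r →
    (H : Hypergraph n r) → Linear H → ¬ ContainsCrown H k →
    (κ : Subset n → ℕ) → IsCrownNumber H κ →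
    crownSum H κ ≤ℚ (+ (n ∸ countDegAtLeast H ((k ∸ 1) * (r ∸ 1) + 2))) / r
proposition1 r k n 3≤k k≤r H linear crown-free κ isCrownNumber =
  sum-unit-fractions-≤ (λ e → κ e * q) D r (edges H) (All.tabulate 1+κq∣D) total-weight-bound
  where open CrownFree {H = H} linear (≤-trans (n≤1+n 2) 3≤k) k≤r crown-free isCrownNumber
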